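{- Let $S$ be a dcwo, $g:S\to S$ a partial monotonic map, and $s\in S$. Let $G=\{g^n(s)\mid n\in\mathbb N,\ g^n(s)\text{ is defined}\}$. Then there are finitely many directed subfamilies $G_0,G_1,\dots,G_{m-1}$ of $G$ such that: (1) $cl(G)=\bigcup_{j=0}^{m-1}cl(G_j)={\downarrow}\{\bigvee G_0,\bigvee G_1,\dots,\bigvee G_{m-1}\}$; (2) each $G_j$ is either a one-element set $\{g^{p_j}(s)\}$ with $p_j\in\mathbb N$, or a chain of the form $\{g^{p_j+\ell q_j}(s)\mid \ell\in\mathbb N\}$ with $p_j\in\mathbb N$, $q_j\in\mathbb N\setminus\{0\}$ and $g^{p_j}(s)<g^{p_j+q_j}(s)$; (3) for every $j$ with $0\leq j<m$, $s\not<g^{p_j}(s)$.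
   Context: A dcpo is a poset in which every directed subset (nonempty, with any two elements having an upper bound inside it) has a supremum $\bigvee$. A well partial order is a poset in which every infinite sequence has $i<j$ with $x_i\leq x_j$; a dcwo is a dcpo whose order is a well partial order. A partial map $g$ is partial monotonic iff $\mathrm{dom}\,g$ is upward-closed and $g$ is monotonic on its domain. $cl(A)$ denotes the closure of $A$ in the Scott topology (open sets: upward-closed sets meeting every directed set whose supremum they contain). ${\downarrow}E$ is the downward closure of $E$. -}

module Defs where

open import Level using (0ℓ) renaming (suc to lsuc)
open import Data.Nat using (ℕ; zero; suc; _+_; _*_)
open import Data.Fin using (Fin)
open import Data.Maybe using (Maybe; just; nothing; _>>=_)
open import Data.Product using (Σ; ∃; ∃-syntax; _×_; _,_)
open import Data.Sum using (_⊎_)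
open import Relation.Nullary using (¬_)
open import Relation.Unary using (Pred; _≐_)
open import Relation.Binary.PropositionalEquality using (_≡_; _≢_)

-- Partial maps S ⇀ S are modelled as total functions S → Maybe S.
-- Iterates: iter g n x = g^n(x) (nothing = undefined).
iter : {S : Set} → (S → Maybe S) → ℕ → S → Maybe S
iter g zero    x = just x
iter g (suc n) x = iter g n x >>= g

Defined : {S : Set} → Maybe S → Set
Defined m = ∃ λ y → m ≡ just y

module Order {S : Set} (_≤_ : S → S → Set) where

  _<_ : S → S → Set
  x < y = x ≤ y × x ≢ y

  Directed : Pred S 0ℓ → Set
  Directed D = (∃ λ x → D x)
             × (∀ x y → D x → D y → ∃ λ z → D z × x ≤ z × y ≤ z)

  IsSup : Pred S 0ℓ → S → Set
  IsSup D u = (∀ x → D x → x ≤ u)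
            × (∀ v → (∀ x → D x → x ≤ v) → u ≤ v)

  IsDcpo : Set₁
  IsDcpo = ∀ (D : Pred S 0ℓ) → Directed D → ∃ λ u → IsSup D u

  IsWpo : Set
  IsWpo = ∀ (f : ℕ → S) → ∃ λ i → ∃ λ j → i Data.Nat.< j × f i ≤ f j

  PartialMonotonic : (S → Maybe S) → Set
  PartialMonotonic g =
      (∀ x y → x ≤ y → Defined (g x) → Defined (g y))
    × (∀ x y x' y' → x ≤ y → g x ≡ just x' → g y ≡ just y' → x' ≤ y')

  IsScottOpen : Pred S 0ℓ → Set₁
  IsScottOpen U = (∀ x y → x ≤ y → U x → U y)
                × (∀ (D : Pred S 0ℓ) → Directed D → ∀ u → IsSup D u → U u
                     → ∃ λ x → D x × U x)

  cl : Pred S 0ℓ → Pred S (lsuc 0ℓ)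
  cl A x = ∀ (U : Pred S 0ℓ) → IsScottOpen U → U x → ∃ λ y → A y × U y

  ↓fin : {m : ℕ} → (Fin m → S) → Pred S 0ℓ
  ↓fin u x = ∃ λ j → x ≤ u j

  ⋃fin : {m : ℕ} → (Fin m → Pred S (lsuc 0ℓ)) → Pred S (lsuc 0ℓ)
  ⋃fin F x = ∃ λ j → F j x

  record Shape (g : S → Maybe S) (s : S) (H : Pred S 0ℓ) : Set where
    field
      p     : ℕ
      a     : S
      a-def : iter g p s ≡ just a
      kind  : (H ≐ (λ x → x ≡ a))
            ⊎ (Σ ℕ λ q → q ≢ 0
                 × (∀ ℓ → Defined (iter g (p + ℓ * q) s))
                 × (H ≐ (λ x → ∃ λ ℓ → iter g (p + ℓ * q) s ≡ just x))
                 × (∃ λ b → iter g (p + q) s ≡ just b × a < b))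
      not-s<a : ¬ (s < a)

-- Say n ≼ m if orb m is defined and above orb n whenever orb n is
-- defined; by monotonicity n ≼ m implies k + n ≼ k + m, so b ≼ b + q makes the
-- orbit increase along the progression b, b + q, b + 2q, … .  If the orbit is
-- finite, the constant progressions at its points cover it; otherwise the
-- well partial order condition yields i < j with orb i ≤ orb j, and the
-- progressions at b < i (constant) and at i ≤ b < j (period j - i) cover it.
-- Each increasing progression is covered by one piece of the required shape:
-- a singleton or a chain if its start is not strictly above s, and otherwise
-- the chain s, orb p, orb 2p, … with s < orb p, which is cofinal among the
-- points above s.
--
-- In a preorder, under excluded middle, a finitely generated lower
-- set ↓{u j} is Scott-closed.  Hence if finitely many directed subsets H j of A
-- with suprema u j are cofinal in A, then cl A = ⋃ cl (H j) = ↓{u j}.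
module Submission where

open import Defs
open import Level using (0ℓ)
open import Axiom.ExcludedMiddle using (ExcludedMiddle)
open import Axiom.DoubleNegationElimination using (em⇒dne)
open import Data.Nat using (ℕ; zero; suc; _+_; _*_; _∸_; z≤n; s≤s; NonZero)
import Data.Nat as ℕ
open import Data.Nat.Properties
  using (+-identityʳ; +-comm; +-assoc; +-suc; *-comm; m∸n+n≡m; m+[n∸m]≡n; m≤m+n; m≤n+m
        ; m≤n⇒m<n∨m≡n; m≤n⇒∃[o]m+o≡n; ≮⇒≥; <⇒≱; <-≤-trans; +-monoʳ-<; _<?_)
open import Data.Nat.DivMod using (_%_; _/_; m≡m%n+[m/n]*n; m%n<n)
open import Data.Nat.Tactic.RingSolver using (solve-∀)
open import Data.Fin using (Fin; toℕ; fromℕ<) renaming (zero to fzero; suc to fsuc)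
open import Data.Fin.Properties using (toℕ-fromℕ<)
open import Data.Maybe using (Maybe; just; nothing; _>>=_)
open import Data.Maybe.Properties using (just-injective)
open import Data.Product using (Σ; ∃; _×_; _,_; proj₁; proj₂)
open import Data.Sum using (inj₁; inj₂)
open import Data.Empty using (⊥-elim)
open import Relation.Nullary using (¬_; yes; no)
open import Relation.Unary using (Pred; _⊆_; _≐_)
open import Relation.Binary.PropositionalEquality
  using (_≡_; _≢_; refl; sym; trans; cong; subst; subst₂; module ≡-Reasoning)
open import Relation.Binary.Structures using (IsPreorder; IsPartialOrder)

module ScottClosure (em : ExcludedMiddle 0ℓ) {S : Set} {_≤_ : S → S → Set}
  (pre : IsPreorder _≡_ _≤_) where

  open Order _≤_
  open IsPreorder pre using () renaming (refl to ≤-refl; trans to ≤-trans)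

  counterexample : {P Q : Pred S 0ℓ} → ¬ (P ⊆ Q) → ∃ λ x → P x × ¬ Q x
  counterexample {P} {Q} ¬P⊆Q with em {∃ λ x → P x × ¬ Q x}
  ... | yes ce = ce
  ... | no ¬ce = ⊥-elim (¬P⊆Q λ {x} Px → em⇒dne em λ ¬Qx → ¬ce (x , Px , ¬Qx))

  -- A directed set lying below finitely many points lies below one of them:
  -- if it is not below u 0, its part above a witness d₀ ≰ u 0 is directed,
  -- lies below the remaining points, and is cofinal in the whole set.
  directed-below-one : ∀ {m} (u : Fin m → S) {D : Pred S 0ℓ} → Directed D
                     → D ⊆ ↓fin u → ∃ λ j → ∀ {d} → D d → d ≤ u j
  directed-below-one {zero} u ((d , Dd) , _) D⊆↓u with D⊆↓u Dd
  ... | () , _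
  directed-below-one {suc m} u {D} dirD@(_ , bound) D⊆↓u with em {D ⊆ λ d → d ≤ u fzero}
  ... | yes below = fzero , below
  ... | no ¬below with counterexample ¬below
  ...   | d₀ , Dd₀ , d₀≰u₀ =
    let (j , D₀≤uj) = directed-below-one (λ j → u (fsuc j)) directed₀ D₀-below-rest
    in fsuc j , λ {d} Dd → let (z , Dz , d≤z , d₀≤z) = bound d d₀ Dd Dd₀ in ≤-trans d≤z (D₀≤uj (Dz , d₀≤z))
    where
    D₀ : Pred S 0ℓ
    D₀ d = D d × d₀ ≤ d

    directed₀ : Directed D₀
    directed₀ = (d₀ , Dd₀ , ≤-refl) , λ a b (Da , d₀≤a) (Db , _) →
      let (z , Dz , a≤z , b≤z) = bound a b Da Db in z , (Dz , ≤-trans d₀≤a a≤z) , a≤z , b≤z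

    D₀-below-rest : D₀ ⊆ ↓fin (λ j → u (fsuc j))
    D₀-below-rest (Dd , d₀≤d) with D⊆↓u Dd
    ... | fzero  , d≤u₀ = ⊥-elim (d₀≰u₀ (≤-trans d₀≤d d≤u₀))
    ... | fsuc j , d≤uj = j , d≤uj

  ↓fin-complement-open : ∀ {m} (u : Fin m → S) → IsScottOpen (λ x → ¬ ↓fin u x)
  ↓fin-complement-open u = upward , inaccessible
    where
    upward : ∀ x y → x ≤ y → ¬ ↓fin u x → ¬ ↓fin u y
    upward x y x≤y x∉ (j , y≤uj) = x∉ (j , ≤-trans x≤y y≤uj)

    inaccessible : ∀ (D : Pred S 0ℓ) → Directed D → ∀ v → IsSup D v → ¬ ↓fin u v
                 → ∃ λ x → D x × ¬ ↓fin u x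
    inaccessible D dirD v (_ , least) v∉ with em {D ⊆ ↓fin u}
    ... | no ¬D⊆↓u = counterexample ¬D⊆↓u
    ... | yes D⊆↓u =
      let (j , D≤uj) = directed-below-one u dirD D⊆↓u
      in ⊥-elim (v∉ (j , least (u j) λ _ → D≤uj))

  cl-below-↓fin : ∀ {m} (u : Fin m → S) {A : Pred S 0ℓ} → A ⊆ ↓fin u → cl A ⊆ ↓fin u
  cl-below-↓fin u A⊆↓u {y} y∈clA with em {↓fin u y}
  ... | yes y∈↓u = y∈↓u
  ... | no y∉↓u with y∈clA _ (↓fin-complement-open u) y∉↓u
  ...   | z , Az , z∉↓u = ⊥-elim (z∉↓u (A⊆↓u Az))

  ↓sup⊆cl : ∀ {D : Pred S 0ℓ} {u} → Directed D → IsSup D u → (_≤ u) ⊆ cl D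
  ↓sup⊆cl dirD supD x≤u U (upward , inaccessible) Ux =
    inaccessible _ dirD _ supD (upward _ _ x≤u Ux)

  cl-mono : ∀ {A B : Pred S 0ℓ} → A ⊆ B → cl A ⊆ cl B
  cl-mono A⊆B x∈clA U openU Ux = let (y , Ay , Uy) = x∈clA U openU Ux in y , A⊆B Ay , Uy

  closure-of-cofinal-family : ∀ {m} {A : Pred S 0ℓ} (H : Fin m → Pred S 0ℓ) (u : Fin m → S)
    → (∀ j → Directed (H j)) → (∀ j → IsSup (H j) (u j)) → (∀ j → H j ⊆ A)
    → (∀ {y} → A y → ∃ λ j → ∃ λ z → H j z × y ≤ z)
    → (cl A ≐ ⋃fin (λ j → cl (H j))) × (⋃fin (λ j → cl (H j)) ≐ ↓fin u)
  closure-of-cofinal-family {A = A} H u dir sup H⊆A cofinal =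
    ((λ x∈clA → ↓⊆⋃cl (clA⊆↓ x∈clA)) , ⋃cl⊆clA) , ((λ x∈⋃ → clA⊆↓ (⋃cl⊆clA x∈⋃)) , ↓⊆⋃cl)
    where
    A⊆↓ : A ⊆ ↓fin u
    A⊆↓ Ay = let (j , z , Hz , y≤z) = cofinal Ay in j , ≤-trans y≤z (proj₁ (sup j) z Hz)

    clA⊆↓ : cl A ⊆ ↓fin u
    clA⊆↓ = cl-below-↓fin u A⊆↓

    ↓⊆⋃cl : ↓fin u ⊆ ⋃fin (λ j → cl (H j))
    ↓⊆⋃cl (j , x≤uj) = j , ↓sup⊆cl (dir j) (sup j) x≤uj

    ⋃cl⊆clA : ⋃fin (λ j → cl (H j)) ⊆ cl A
    ⋃cl⊆clA (j , x∈clHj) = cl-mono (H⊆A j) x∈clHj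

module Orbit (em : ExcludedMiddle 0ℓ) {S : Set} {_≤_ : S → S → Set}
  (pre : IsPreorder _≡_ _≤_) (g : S → Maybe S) (pm : Order.PartialMonotonic _≤_ g)
  (s : S) where

  open Order _≤_
  open IsPreorder pre using () renaming (refl to ≤-refl; trans to ≤-trans; reflexive to ≤-reflexive)

  orb : ℕ → Maybe S
  orb n = iter g n s

  G : Pred S 0ℓ
  G y = ∃ λ n → orb n ≡ just y

  orb-unique : ∀ n {y y'} → orb n ≡ just y → orb n ≡ just y' → y ≡ y'
  orb-unique n e e' = just-injective (trans (sym e) e')

  undefined-after : ∀ {n} → orb n ≡ nothing → ∀ d → orb (d + n) ≡ nothing
  undefined-after undefined zero    = undefined
  undefined-after undefined (suc d) = cong (_>>= g) (undefined-after undefined d)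

  defined-below : ∀ {n m y} → n ℕ.≤ m → orb m ≡ just y → orb n ≢ nothing
  defined-below {n} {m} n≤m e undefined
    with trans (sym e) (subst (λ k → orb k ≡ nothing) (m∸n+n≡m n≤m) (undefined-after undefined (m ∸ n)))
  ... | ()

  orb-cong : ∀ {n m} → orb n ≡ orb m → ∀ k → orb (k + n) ≡ orb (k + m)
  orb-cong e zero    = e
  orb-cong e (suc k) = cong (_>>= g) (orb-cong e k)

  infix 4 _≼_
  record _≼_ (n m : ℕ) : Set where
    constructor lift
    field raise : ∀ {y} → orb n ≡ just y → ∃ λ y' → orb m ≡ just y' × y ≤ y'
  open _≼_ public

  ≼-refl : ∀ {n} → n ≼ n
  ≼-refl = lift λ e → _ , e , ≤-refl

  ≼-reflexive : ∀ {n m} → n ≡ m → n ≼ m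
  ≼-reflexive refl = ≼-refl

  ≼-trans : ∀ {n m k} → n ≼ m → m ≼ k → n ≼ k
  ≼-trans n≼m m≼k = lift λ e →
    let (y' , e' , y≤y') = raise n≼m e ; (y'' , e'' , y'≤y'') = raise m≼k e'
    in y'' , e'' , ≤-trans y≤y' y'≤y''

  ≼-intro : ∀ {n m y y'} → orb n ≡ just y → orb m ≡ just y' → y ≤ y' → n ≼ m
  ≼-intro {n} e e' y≤y' = lift λ e₁ → _ , e' , subst (_≤ _) (orb-unique n e e₁) y≤y'

  ≼-elim : ∀ {n m y y'} → n ≼ m → orb n ≡ just y → orb m ≡ just y' → y ≤ y'
  ≼-elim {m = m} n≼m e e' =
    let (_ , e'' , y≤y'') = raise n≼m e in subst (_ ≤_) (orb-unique m e'' e') y≤y''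

  bind-just : ∀ (mw : Maybe S) {z} → (mw >>= g) ≡ just z → ∃ λ w → mw ≡ just w × g w ≡ just z
  bind-just (just w) e = w , refl , e

  ≼-shift : ∀ k {n m} → n ≼ m → k + n ≼ k + m
  ≼-shift zero    n≼m = n≼m
  ≼-shift (suc k) {n} {m} n≼m = lift step
    where
    step : ∀ {z} → orb (suc k + n) ≡ just z → ∃ λ z' → orb (suc k + m) ≡ just z' × z ≤ z'
    step {z} e with bind-just (orb (k + n)) e
    ... | w , e₀ , gw with raise (≼-shift k n≼m) e₀
    ...   | w' , e₀' , w≤w' with proj₁ pm w w' w≤w' (z , gw)
    ...     | z' , gw' = z' , trans (cong (_>>= g) e₀') gw' , proj₂ pm w w' z z' w≤w' gw gw'

  progression-step : ∀ {b q} → b ≼ b + q → ∀ ℓ → b + ℓ * q ≼ b + suc ℓ * q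
  progression-step {b} {q} inc ℓ =
    subst₂ _≼_ (+-comm (ℓ * q) b) (reorder (ℓ * q) b q) (≼-shift (ℓ * q) inc)
    where
    reorder : ∀ a b q → a + (b + q) ≡ b + (q + a)
    reorder = solve-∀

  progression-mono : ∀ {b q} → b ≼ b + q → ∀ {ℓ ℓ'} → ℓ ℕ.≤ ℓ' → b + ℓ * q ≼ b + ℓ' * q
  progression-mono inc {ℓ' = zero} z≤n = ≼-refl
  progression-mono inc {ℓ' = suc ℓ'} ℓ≤ℓ' with m≤n⇒m<n∨m≡n ℓ≤ℓ'
  ... | inj₁ (s≤s ℓ≤ℓ'') = ≼-trans (progression-mono inc ℓ≤ℓ'') (progression-step inc ℓ')
  ... | inj₂ refl = ≼-refl

  progression-start : ∀ b q → b + 0 * q ≡ b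
  progression-start b _ = +-identityʳ b

  progression-constant : ∀ {b q} → orb b ≡ orb (b + q) → ∀ ℓ → orb (b + ℓ * q) ≡ orb b
  progression-constant {b} {q} eq zero = cong orb (progression-start b q)
  progression-constant {b} {q} eq (suc ℓ) = begin
    orb (b + (q + ℓ * q))  ≡⟨ cong orb (reorder b q (ℓ * q)) ⟩
    orb (ℓ * q + (b + q))  ≡⟨ orb-cong (sym eq) (ℓ * q) ⟩
    orb (ℓ * q + b)        ≡⟨ cong orb (+-comm (ℓ * q) b) ⟩
    orb (b + ℓ * q)        ≡⟨ progression-constant {b} {q} eq ℓ ⟩
    orb b                  ∎
    where
    open ≡-Reasoning
    reorder : ∀ b q a → b + (q + a) ≡ a + (b + q)
    reorder = solve-∀

  s≮s : ¬ (s < s)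
  s≮s s<s = proj₂ s<s refl

  record Piece : Set₁ where
    field
      H     : Pred S 0ℓ
      sub   : H ⊆ G
      dir   : Directed H
      shape : Shape g s H

  Covers : Piece → ℕ → Set
  Covers P n = ∀ {y} → orb n ≡ just y → ∃ λ z → Piece.H P z × y ≤ z

  ProgressionPiece : ℕ → ℕ → Set₁
  ProgressionPiece b q = Σ Piece λ P → ∀ ℓ → Covers P (b + ℓ * q)

  singletonPiece : ∀ b {c} → orb b ≡ just c → ¬ (s < c) → Piece
  singletonPiece b {c} e s≮c = record
    { H     = _≡ c
    ; sub   = λ { refl → b , e }
    ; dir   = (c , refl) , λ { _ _ refl refl → c , refl , ≤-refl , ≤-refl }
    ; shape = record { p = b ; a = c ; a-def = e ; kind = inj₁ ((λ h → h) , (λ h → h))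
                     ; not-s<a = s≮c } }

  -- The chain piece {g^(b + ℓq)(s) | ℓ ∈ ℕ}, when g^b(s) < g^(b+q)(s); it is
  -- directed because the orbit increases along the progression.
  chainPiece : ∀ b q {c c'} → orb b ≡ just c → orb (b + q) ≡ just c' → c < c' → ¬ (s < c)
             → ProgressionPiece b q
  chainPiece b q {c} {c'} e e' c<c' s≮c = piece , λ ℓ eℓ → _ , (ℓ , eℓ) , ≤-refl
    where
    increasing : b ≼ b + q
    increasing = ≼-intro e e' (proj₁ c<c')

    Chain : Pred S 0ℓ
    Chain y = ∃ λ ℓ → orb (b + ℓ * q) ≡ just y

    start : orb (b + 0 * q) ≡ just c
    start = trans (cong orb (progression-start b q)) e

    period≢0 : q ≢ 0
    period≢0 refl = proj₂ c<c' (orb-unique b e (trans (cong orb (sym (+-identityʳ b))) e'))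

    defined : ∀ ℓ → Defined (orb (b + ℓ * q))
    defined ℓ = let (y , eℓ , _) = raise (progression-mono increasing {ℓ' = ℓ} z≤n) start in y , eℓ

    upper : ∀ y₁ y₂ → Chain y₁ → Chain y₂ → ∃ λ z → Chain z × y₁ ≤ z × y₂ ≤ z
    upper y₁ y₂ (ℓ₁ , e₁) (ℓ₂ , e₂) =
      let (z , ez) = defined (ℓ₁ + ℓ₂)
      in z , (ℓ₁ + ℓ₂ , ez)
           , ≼-elim (progression-mono increasing (m≤m+n ℓ₁ ℓ₂)) e₁ ez
           , ≼-elim (progression-mono increasing (m≤n+m ℓ₂ ℓ₁)) e₂ ez

    piece : Piece
    piece = record
      { H     = Chain
      ; sub   = λ (ℓ , eℓ) → b + ℓ * q , eℓ
      ; dir   = (c , 0 , start) , upper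
      ; shape = record { p = b ; a = c ; a-def = e
                       ; kind = inj₂ (q , period≢0 , defined , ((λ h → h) , (λ h → h)) , (c' , e' , c<c'))
                       ; not-s<a = s≮c } }

  basicPiece : ∀ b q {c} → b ≼ b + q → orb b ≡ just c → ¬ (s < c) → ProgressionPiece b q
  basicPiece b q {c} inc e s≮c with raise inc e
  ... | c' , e' , c≤c' with em {c ≡ c'}
  ...   | no c≢c' = chainPiece b q e e' (c≤c' , c≢c') s≮c
  ...   | yes refl = singletonPiece b e s≮c
                   , λ ℓ eℓ → c , refl , ≤-reflexive (orb-unique (b + ℓ * q) eℓ (constant ℓ))
    where
    constant : ∀ ℓ → orb (b + ℓ * q) ≡ just c
    constant ℓ = trans (progression-constant {b} {q} (trans e (sym e')) ℓ) e

  -- If g^p(s) lies strictly above s, the chain s, g^p(s), g^(2p)(s), … is a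
  -- piece which covers every iterate above s: for s ≤ g^n(s) one has
  -- g^n(s) ≤ g^(pn)(s), by monotonicity along the progression n, 2n, … .
  abovePiece : ∀ p {c} → orb p ≡ just c → s < c
             → Σ Piece λ P → ∀ n {y} → orb n ≡ just y → s ≤ y → ∃ λ z → Piece.H P z × y ≤ z
  abovePiece zero    e s<c = ⊥-elim (proj₂ s<c (just-injective e))
  abovePiece (suc p) e s<c = P , covers
    where
    chain : ProgressionPiece 0 (suc p)
    chain = basicPiece 0 (suc p) (≼-intro refl e (proj₁ s<c)) refl s≮s

    P : Piece
    P = proj₁ chain

    covers : ∀ n {y} → orb n ≡ just y → s ≤ y → ∃ λ z → Piece.H P z × y ≤ z
    covers n {y} e s≤y with raise (progression-mono (≼-intro {0} {n} refl e s≤y) {1} {suc p} (s≤s z≤n))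
                               (trans (cong orb (+-identityʳ n)) e)
    ... | w , ew , y≤w with proj₂ chain n (trans (cong orb (*-comm n (suc p))) ew)
    ...   | z , Pz , w≤z = z , Pz , ≤-trans y≤w w≤z

  orbitPiece : ∀ b q → b ≼ b + q → ProgressionPiece b q
  orbitPiece b q inc with orb b in e
  ... | nothing = singletonPiece 0 refl s≮s
                , λ ℓ eℓ → ⊥-elim (defined-below (m≤m+n b (ℓ * q)) eℓ e)
  ... | just c with em {s < c}
  ...   | no s≮c = basicPiece b q inc e s≮c
  ...   | yes s<c with abovePiece b e s<c
  ...     | P , covers = P , λ ℓ eℓ → covers (b + ℓ * q) eℓ
                           (≤-trans (proj₁ s<c) (≼-elim (progression-mono inc {ℓ' = ℓ} z≤n) start eℓ))
    where
    start : orb (b + 0 * q) ≡ just c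
    start = trans (cong orb (progression-start b q)) e

  record ProgressionCover : Set where
    field
      K          : ℕ
      period     : ℕ → ℕ
      increasing : ∀ b → b ≼ b + period b
      complete   : ∀ n {y} → orb n ≡ just y
                 → ∃ λ (j : Fin K) → ∃ λ ℓ → n ≡ toℕ j + ℓ * period (toℕ j)

  finiteCover : ∀ N → orb N ≡ nothing → ProgressionCover
  finiteCover N undefined = record
    { K = N ; period = λ _ → 0 ; increasing = λ b → ≼-reflexive (sym (+-identityʳ b)) ; complete = complete }
    where
    complete : ∀ n {y} → orb n ≡ just y → ∃ λ (j : Fin N) → ∃ λ ℓ → n ≡ toℕ j + ℓ * 0
    complete n e with n <? N
    ... | yes n<N = fromℕ< n<N , 0 , sym (trans (+-identityʳ _) (toℕ-fromℕ< n<N))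
    ... | no n≮N = ⊥-elim (defined-below (≮⇒≥ n≮N) e undefined)

  module Cyclic (i q : ℕ) .{{_ : NonZero q}} (inc : i ≼ i + q) where

    period : ℕ → ℕ
    period b with b <? i
    ... | yes _ = 0
    ... | no _  = q

    increasing : ∀ b → b ≼ b + period b
    increasing b with b <? i
    ... | yes _  = ≼-reflexive (sym (+-identityʳ b))
    ... | no b≮i = subst₂ _≼_ (m∸n+n≡m i≤b) shifted (≼-shift (b ∸ i) inc)
      where
      i≤b : i ℕ.≤ b
      i≤b = ≮⇒≥ b≮i
      shifted : (b ∸ i) + (i + q) ≡ b + q
      shifted = trans (sym (+-assoc (b ∸ i) i q)) (cong (_+ q) (m∸n+n≡m i≤b))

    period-above : ∀ r → period (i + r) ≡ q
    period-above r with i + r <? i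
    ... | yes i+r<i = ⊥-elim (<⇒≱ i+r<i (m≤m+n i r))
    ... | no _ = refl

    complete : ∀ n {y} → orb n ≡ just y
             → ∃ λ (j : Fin (i + q)) → ∃ λ ℓ → n ≡ toℕ j + ℓ * period (toℕ j)
    complete n _ with n <? i
    ... | yes n<i = fromℕ< n<i+q , 0 , sym (trans (+-identityʳ _) (toℕ-fromℕ< n<i+q))
      where
      n<i+q : n ℕ.< i + q
      n<i+q = <-≤-trans n<i (m≤m+n i q)
    ... | no n≮i = fromℕ< bound , ℓ , decomposition
      where
      r ℓ : ℕ
      r = (n ∸ i) % q
      ℓ = (n ∸ i) / q
      bound : i + r ℕ.< i + q
      bound = +-monoʳ-< i (m%n<n (n ∸ i) q)
      open ≡-Reasoning
      decomposition : n ≡ toℕ (fromℕ< bound) + ℓ * period (toℕ (fromℕ< bound))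
      decomposition = begin
        n                             ≡⟨ sym (m+[n∸m]≡n (≮⇒≥ n≮i)) ⟩
        i + (n ∸ i)                   ≡⟨ cong (i +_) (m≡m%n+[m/n]*n (n ∸ i) q) ⟩
        i + (r + ℓ * q)               ≡⟨ sym (+-assoc i r (ℓ * q)) ⟩
        (i + r) + ℓ * q               ≡⟨ cong (λ p → (i + r) + ℓ * p) (sym (period-above r)) ⟩
        (i + r) + ℓ * period (i + r)  ≡⟨ cong (λ b → b + ℓ * period b) (sym (toℕ-fromℕ< bound)) ⟩
        toℕ (fromℕ< bound) + ℓ * period (toℕ (fromℕ< bound)) ∎

    cover : ProgressionCover
    cover = record { K = i + q ; period = period ; increasing = increasing ; complete = complete }

  progressionCover : IsWpo → ProgressionCover
  progressionCover wpo with em {∃ λ N → orb N ≡ nothing}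
  ... | yes (N , undefined) = finiteCover N undefined
  ... | no infinite = cyclic (wpo value)
    where
    defined : ∀ n → Defined (orb n)
    defined n with orb n in e
    ... | just y  = y , refl
    ... | nothing = ⊥-elim (infinite (n , e))

    value : ℕ → S
    value n = proj₁ (defined n)

    cyclic : (∃ λ i → ∃ λ j → i ℕ.< j × value i ≤ value j) → ProgressionCover
    cyclic (i , j , i<j , vi≤vj) with m≤n⇒∃[o]m+o≡n i<j
    ... | o , refl = Cyclic.cover i (suc o) (≼-intro (proj₂ (defined i)) ej vi≤vj)
      where
      ej : orb (i + suc o) ≡ just (value (suc i + o))
      ej = subst (λ k → orb k ≡ just (value (suc i + o))) (sym (+-suc i o)) (proj₂ (defined (suc i + o)))

  record PieceCover : Set₁ where
    field
      m       : ℕ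
      piece   : Fin m → Piece
      cofinal : ∀ {y} → G y → ∃ λ j → ∃ λ z → Piece.H (piece j) z × y ≤ z

  pieceCover : ProgressionCover → PieceCover
  pieceCover C = record { m = K ; piece = λ j → proj₁ (pieceAt j) ; cofinal = cofinal }
    where
    open ProgressionCover C

    pieceAt : (j : Fin K) → ProgressionPiece (toℕ j) (period (toℕ j))
    pieceAt j = orbitPiece (toℕ j) (period (toℕ j)) (increasing (toℕ j))

    cofinal : ∀ {y} → G y → ∃ λ j → ∃ λ z → Piece.H (proj₁ (pieceAt j)) z × y ≤ z
    cofinal (n , e) with complete n e
    ... | j , ℓ , refl = j , proj₂ (pieceAt j) ℓ e

lemma5p19 : ExcludedMiddle 0ℓ → ExcludedMiddle (Level.suc 0ℓ)
    → (S : Set) (_≤_ : S → S → Set)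
    → IsPartialOrder _≡_ _≤_
    → Order.IsDcpo _≤_
    → Order.IsWpo _≤_
    → (g : S → Maybe S) → Order.PartialMonotonic _≤_ g
    → (s : S)
    → let G : Pred S 0ℓ
          G = λ x → ∃ λ n → iter g n s ≡ just x
      in Σ ℕ λ m → Σ (Fin m → Pred S 0ℓ) λ H → Σ (Fin m → S) λ u →
           (∀ j → H j ⊆ G)
         × (∀ j → Order.Directed _≤_ (H j))
         × (∀ j → Order.IsSup _≤_ (H j) (u j))
         × (Order.cl _≤_ G ≐ Order.⋃fin _≤_ (λ j → Order.cl _≤_ (H j)))
         × (Order.⋃fin _≤_ (λ j → Order.cl _≤_ (H j)) ≐ Order.↓fin _≤_ u)
         × (∀ j → Order.Shape _≤_ g s (H j))
lemma5p19 em _ S _≤_ po dcpo wpo g pm s =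
  m , H , u , (λ j → Piece.sub (piece j)) , dir , sup
    , proj₁ closure , proj₂ closure , (λ j → Piece.shape (piece j))
  where
  pre : IsPreorder _≡_ _≤_
  pre = IsPartialOrder.isPreorder po
  open Orbit em pre g pm s
  open ScottClosure em pre
  open PieceCover (pieceCover (progressionCover wpo))

  H : Fin m → Pred S 0ℓ
  H j = Piece.H (piece j)

  dir : ∀ j → Order.Directed _≤_ (H j)
  dir j = Piece.dir (piece j)

  u : Fin m → S
  u j = proj₁ (dcpo (H j) (dir j))

  sup : ∀ j → Order.IsSup _≤_ (H j) (u j)
  sup j = proj₂ (dcpo (H j) (dir j))

  closure : (Order.cl _≤_ G ≐ Order.⋃fin _≤_ (λ j → Order.cl _≤_ (H j)))
          × (Order.⋃fin _≤_ (λ j → Order.cl _≤_ (H j)) ≐ Order.↓fin _≤_ u)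
  closure = closure-of-cofinal-family H u dir sup (λ j → Piece.sub (piece j)) cofinal
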